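{- Every graph with pathwidth at most $w$ has a vertex 2-colouring such that every monochromatic path has at most $(w+3)^w$ vertices.
   Context: All graphs are finite and simple. A vertex 2-colouring is an arbitrary (not necessarily proper) assignment of one of two colours to each vertex. A monochromatic path is a path all of whose vertices have the same colour. A path-decomposition of $G$ is a sequence $(B_1,\dots,B_n)$ of subsets of $V(G)$ such that: - for each vertex $v$, the set $\{i : v\in B_i\}$ is an interval; - each edge has both endpoints in some $B_i$. Its width is $\max_i|B_i|-1$. The pathwidth of $G$ is the minimum width of a path-decomposition of $G$. -}

module Defs where

open import Data.Nat using (ℕ; _≤_; _∸_; _+_)
open import Data.Fin using (Fin; toℕ)
open import Data.Fin.Subset using (Subset; _∈_; ∣_∣)
open import Data.Bool using (Bool)
open import Data.List using (List; []; _∷_; length)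
open import Data.List.Relation.Unary.All using (All)
open import Data.List.Relation.Unary.Unique.Propositional using (Unique)
open import Data.Product using (Σ; _×_; ∃)
open import Relation.Binary.PropositionalEquality using (_≡_)
open import Relation.Nullary using (¬_)
open import Data.Unit using (⊤)

record Graph (n : ℕ) : Set₁ where
  field
    Adj   : Fin n → Fin n → Set
    sym   : ∀ {u v} → Adj u v → Adj v u
    irrefl : ∀ {v} → ¬ Adj v v

open Graph public

record PathDecomposition {n : ℕ} (G : Graph n) : Set where
  field
    len      : ℕ
    bag      : Fin len → Subset n
    interval : ∀ (v : Fin n) (i j k : Fin len) →
               toℕ i ≤ toℕ j → toℕ j ≤ toℕ k →
               v ∈ bag i → v ∈ bag k → v ∈ bag j
    edges    : ∀ (u v : Fin n) → Adj G u v → ∃ λ (i : Fin len) → (u ∈ bag i) × (v ∈ bag i)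

open PathDecomposition public

-- The width is max_i |B_i| - 1; "width ≤ w" means every bag has at most w + 1 vertices.
WidthAtMost : ∀ {n} {G : Graph n} → PathDecomposition G → ℕ → Set
WidthAtMost D w = ∀ (i : Fin (len D)) → ∣ bag D i ∣ ≤ w + 1

PathwidthAtMost : ∀ {n} → Graph n → ℕ → Set
PathwidthAtMost G w = Σ (PathDecomposition G) λ D → WidthAtMost D w

Walk : ∀ {n} → Graph n → List (Fin n) → Set
Walk G []            = ⊤
Walk G (v ∷ [])      = ⊤
Walk G (u ∷ v ∷ vs)  = Adj G u v × Walk G (v ∷ vs)

IsPath : ∀ {n} → Graph n → List (Fin n) → Set
IsPath G vs = ¬ (vs ≡ []) × Unique vs × Walk G vs

-- vertex 2-colouring (arbitrary, not necessarily proper)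
Colouring : ℕ → Set
Colouring n = Fin n → Bool

Monochromatic : ∀ {n} → Colouring n → List (Fin n) → Set
Monochromatic {n} c vs = ∃ λ (b : Bool) → All (λ v → c v ≡ b) vs

-- Induction on the largest number p of vertices of the current vertex set U in a bag.
-- Scan the bags from left to right and call a bag a cut when none of its U-vertices
-- lies on an earlier cut.  Cuts are pairwise disjoint on U, and every other bag meets
-- U in a vertex of an earlier cut, so the U-vertices on no cut have at most p - 1
-- vertices in each bag and are coloured recursively.  The U-vertices of the i-th cut
-- get the parity of i.  A path meets every bag between two bags it meets, so a path
-- meeting two cuts also meets the cut right after the first one, of the other colour.
-- Hence a monochromatic path meets only one cut, and its at most p vertices there
-- split it into at most p + 1 recursively coloured pieces: f(p) = p + (p + 1) f(p - 1).
-- For p = 2 the pieces can only be the two end vertices, giving f(2) = 4, and then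
-- f(p) ≤ (p + 2) ^ (p - 1).

{-# OPTIONS --safe #-}
module Submission where

open import Defs hiding (sym)
open import Data.Bool using (Bool; true; false; not)
open import Data.Bool.Properties using (not-¬)
open import Data.Empty using (⊥)
open import Data.Fin using (Fin; toℕ; fromℕ<)
open import Data.Fin.Properties using (any?; toℕ-fromℕ<; fromℕ<-toℕ; toℕ<n)
import Data.Fin.Subset as Subset
import Data.Fin.Subset.Properties as Subset
open import Data.List using (List; []; _∷_; [_]; _++_; length; filter)
open import Data.List.Membership.Propositional using (_∈_)
open import Data.List.Membership.Propositional.Properties using (∈-filter⁻)
open import Data.List.Properties using (++-assoc; length-++; filter-accept)
open import Data.List.Relation.Unary.All as All using (All; []; _∷_)
open import Data.List.Relation.Unary.All.Properties using (++⁻ˡ; ++⁻ʳ; ++⁺)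
open import Data.List.Relation.Unary.AllPairs using ([]; _∷_)
open import Data.List.Relation.Unary.Any using (here; there)
open import Data.List.Relation.Unary.Unique.Propositional using (Unique)
import Data.List.Relation.Unary.Unique.Propositional.Properties as Unique
open import Data.Nat using (ℕ; zero; suc; _+_; _*_; _^_; _≤_; _<_; z≤n; s≤s; s≤s⁻¹; _<?_; >-nonZero)
open import Data.Nat.Properties
open import Data.Nat.Tactic.RingSolver using (solve-∀)
open import Data.Product as Product using (Σ; ∃; _×_; _,_; proj₁; proj₂)
open import Data.Sum using (_⊎_; inj₁; inj₂)
open import Data.Unit using (⊤; tt)
open import Function using (_∘_)
open import Level using (0ℓ)
open import Relation.Binary.Definitions using (tri<; tri≈; tri>)
open import Relation.Binary.PropositionalEquality using (_≡_; _≢_; refl; sym; trans; cong; subst; subst₂)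
open import Relation.Nullary using (¬_; Dec; yes; no; contradiction)
open import Relation.Nullary.Decidable using (¬?; _×-dec_; _⊎-dec_; decidable-stable)
open import Relation.Unary using (Pred; Decidable; ∁)
open import Relation.Unary.Properties using (∁?)

count : {A : Set} {P : Pred A 0ℓ} → Decidable P → List A → ℕ
count P? xs = length (filter P? xs)

module _ {A : Set} {P : Pred A 0ℓ} (P? : Decidable P) where

  -- k elements outside P cut a list into at most k + 1 runs of elements of P.
  length-≤-runs : ∀ (R : Pred (List A) 0ℓ) →
    (∀ xs ys → R (xs ++ ys) → R xs) → (∀ xs ys → R (xs ++ ys) → R ys) →
    ∀ M → (∀ xs → R xs → All P xs → length xs ≤ M) →
    ∀ xs → R xs → length xs ≤ count (∁? P?) xs + suc (count (∁? P?) xs) * M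
  length-≤-runs R prefix suffix M short xs Rxs = go [] xs [] Rxs
    where
    close-run : ∀ {a l k} → a ≤ M → l ≤ k + suc k * M → a + suc l ≤ suc k + suc (suc k) * M
    close-run {k = k} a≤M l≤ = ≤-trans (+-mono-≤ a≤M (s≤s l≤)) (≤-reflexive (equation k M))
      where
      equation : ∀ k M → M + suc (k + suc k * M) ≡ suc k + suc (suc k) * M
      equation = solve-∀

    go : ∀ run xs → All P run → R (run ++ xs) →
         length run + length xs ≤ count (∁? P?) xs + suc (count (∁? P?) xs) * M
    go run [] Prun R[run] =
      subst₂ _≤_ (sym (+-identityʳ _)) (sym (+-identityʳ M))
             (short run (prefix run [] R[run]) Prun)
    go run (x ∷ xs) Prun R[run] with P? x | subst R (sym (++-assoc run [ x ] xs)) R[run]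
    ... | yes px | R[run,x] =
      subst (_≤ count (∁? P?) xs + suc (count (∁? P?) xs) * M)
            (trans (cong (_+ length xs) (length-++ run)) (+-assoc (length run) 1 (length xs)))
            (go (run ++ [ x ]) xs (++⁺ Prun (px ∷ [])) R[run,x])
    ... | no _ | R[run,x] =
      close-run {k = count (∁? P?) xs} (short run (prefix run (x ∷ xs) R[run]) Prun)
                                       (go [] xs [] (suffix (run ++ [ x ]) xs R[run,x]))

module _ {A : Set} {Q : Pred A 0ℓ} (Q? : Decidable Q) where

  AllInner : List A → Set
  AllInner (x ∷ y ∷ z ∷ xs) = Q y × AllInner (y ∷ z ∷ xs)
  AllInner _ = ⊤

  length-≤-1+count : ∀ x xs → AllInner (x ∷ xs) → length xs ≤ suc (count Q? xs)
  length-≤-1+count x [] _ = z≤n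
  length-≤-1+count x (y ∷ []) _ = s≤s z≤n
  length-≤-1+count x (y ∷ z ∷ xs) (qy , inner) =
    subst (λ k → length (y ∷ z ∷ xs) ≤ suc k) (sym (cong length (filter-accept Q? qy)))
          (s≤s (length-≤-1+count y (z ∷ xs) inner))

  length-≤-2+count : ∀ xs → AllInner xs → length xs ≤ 2 + count Q? xs
  length-≤-2+count [] _ = z≤n
  length-≤-2+count (x ∷ xs) inner with Q? x
  ... | yes _ = s≤s (m≤n⇒m≤1+n (length-≤-1+count x xs inner))
  ... | no _ = s≤s (length-≤-1+count x xs inner)

module _ {n : ℕ} (G : Graph n) where

  walk-tail : ∀ {x xs} → Walk G (x ∷ xs) → Walk G xs
  walk-tail {xs = []} _ = tt
  walk-tail {xs = _ ∷ _} (_ , walk) = walk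

  walk-++⁻ˡ : ∀ xs {ys} → Walk G (xs ++ ys) → Walk G xs
  walk-++⁻ˡ [] _ = tt
  walk-++⁻ˡ (x ∷ []) _ = tt
  walk-++⁻ˡ (x ∷ y ∷ xs) (xy , walk) = xy , walk-++⁻ˡ (y ∷ xs) walk

  walk-++⁻ʳ : ∀ xs {ys} → Walk G (xs ++ ys) → Walk G ys
  walk-++⁻ʳ [] walk = walk
  walk-++⁻ʳ (x ∷ xs) walk = walk-++⁻ʳ xs (walk-tail walk)

  MonoPath : Colouring n → Pred (Fin n) 0ℓ → Bool → List (Fin n) → Set
  MonoPath c U b xs = Walk G xs × Unique xs × All U xs × All (λ v → c v ≡ b) xs

  ShortMonoPaths : Colouring n → Pred (Fin n) 0ℓ → ℕ → Set
  ShortMonoPaths c U M = ∀ {b} xs → MonoPath c U b xs → length xs ≤ M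

  module _ {c : Colouring n} {U : Pred (Fin n) 0ℓ} {b : Bool} where

    monoPath-++⁻ˡ : ∀ xs ys → MonoPath c U b (xs ++ ys) → MonoPath c U b xs
    monoPath-++⁻ˡ xs ys (walk , uniq , inside , mono) =
      walk-++⁻ˡ xs walk , unique-++⁻ˡ xs uniq , ++⁻ˡ xs inside , ++⁻ˡ xs mono
      where
      unique-++⁻ˡ : ∀ xs {ys} → Unique (xs ++ ys) → Unique xs
      unique-++⁻ˡ [] _ = []
      unique-++⁻ˡ (x ∷ xs) (x∉ ∷ uniq) = ++⁻ˡ xs x∉ ∷ unique-++⁻ˡ xs uniq

    monoPath-++⁻ʳ : ∀ xs ys → MonoPath c U b (xs ++ ys) → MonoPath c U b ys
    monoPath-++⁻ʳ xs ys (walk , uniq , inside , mono) =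
      walk-++⁻ʳ xs walk , unique-++⁻ʳ xs uniq , ++⁻ʳ xs inside , ++⁻ʳ xs mono
      where
      unique-++⁻ʳ : ∀ xs {ys} → Unique (xs ++ ys) → Unique ys
      unique-++⁻ʳ [] uniq = uniq
      unique-++⁻ʳ (x ∷ xs) (_ ∷ uniq) = unique-++⁻ʳ xs uniq

pathBound : ℕ → ℕ
pathBound 0 = 1
pathBound 1 = 4
pathBound (suc (suc w)) = 3 + w + (4 + w) * pathBound (suc w)

pathBound-≤ : ∀ w → pathBound w ≤ (3 + w) ^ w
pathBound-≤ 0 = ≤-refl
pathBound-≤ 1 = ≤-refl
pathBound-≤ (suc (suc w)) = recurrence-≤ (3 + w) w _ (pathBound-≤ (suc w))
  where
  recurrence-≤ : ∀ a e M → M ≤ suc a ^ suc e → a + suc a * M ≤ suc (suc a) ^ suc (suc e)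
  recurrence-≤ a e M M≤ = begin
    a + suc a * M                       ≤⟨ +-mono-≤ a≤ (*-monoʳ-≤ (suc a) M≤) ⟩
    suc a ^ suc e + suc a ^ suc (suc e) ≡⟨⟩
    suc (suc a) * suc a ^ suc e         ≤⟨ *-monoʳ-≤ (suc (suc a)) (^-monoˡ-≤ (suc e) (n≤1+n (suc a))) ⟩
    suc (suc a) ^ suc (suc e)           ∎
    where
    open ≤-Reasoning
    a≤ : a ≤ suc a ^ suc e
    a≤ = ≤-trans (n≤1+n a) (m≤m*n (suc a) (suc a ^ e) {{>-nonZero (m^n>0 (suc a) e)}})

Between : ℕ → ℕ → ℕ → Set
Between a q b = (a ≤ q × q ≤ b) ⊎ (b ≤ q × q ≤ a)

between-sym : ∀ {a q b} → Between a q b → Between b q a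
between-sym (inj₁ a≤q≤b) = inj₂ a≤q≤b
between-sym (inj₂ b≤q≤a) = inj₁ b≤q≤a

between-split : ∀ {a q b} i → Between a q b → Between a q i ⊎ Between i q b
between-split {q = q} i (inj₁ (a≤q , q≤b)) with ≤-total q i
... | inj₁ q≤i = inj₁ (inj₁ (a≤q , q≤i))
... | inj₂ i≤q = inj₂ (inj₁ (i≤q , q≤b))
between-split {q = q} i (inj₂ (b≤q , q≤a)) with ≤-total q i
... | inj₁ q≤i = inj₂ (inj₂ (b≤q , q≤i))
... | inj₂ i≤q = inj₁ (inj₂ (i≤q , q≤a))

record BagSequence {n : ℕ} (G : Graph n) : Set₁ where
  field
    Bag         : ℕ → Pred (Fin n) 0ℓ
    bag?        : ∀ q → Decidable (Bag q)
    extent      : ℕ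
    bag⇒<extent : ∀ {q v} → Bag q v → q < extent
    bag-convex  : ∀ {i j k v} → i ≤ j → j ≤ k → Bag i v → Bag k v → Bag j v
    bag-edge    : ∀ {u v} → Adj G u v → ∃ λ q → Bag q u × Bag q v

module _ {n : ℕ} {G : Graph n} (D : BagSequence G) where
  open BagSequence D

  bag-between : ∀ {a q b v} → Bag a v → Bag b v → Between a q b → Bag q v
  bag-between va vb (inj₁ (a≤q , q≤b)) = bag-convex a≤q q≤b va vb
  bag-between va vb (inj₂ (b≤q , q≤a)) = bag-convex b≤q q≤a vb va

  walk-meets-between : ∀ xs {x y a q b} → Walk G xs → x ∈ xs → y ∈ xs →
    Bag a x → Bag b y → Between a q b → ∃ λ z → z ∈ xs × Bag q z
  walk-meets-between (h ∷ t) walk (here refl) y∈ xa yb aqb = from-head h t walk xa y∈ yb aqb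
    where
    from-head : ∀ h t {y a q b} → Walk G (h ∷ t) → Bag a h → y ∈ h ∷ t → Bag b y →
                Between a q b → ∃ λ z → z ∈ h ∷ t × Bag q z
    from-head h t _ ha (here refl) yb aqb = h , here refl , bag-between ha yb aqb
    from-head h (h′ ∷ t) (hh′ , walk) ha (there y∈) yb aqb with bag-edge hh′
    ... | i , hi , h′i with between-split i aqb
    ...   | inj₁ aqi = h , here refl , bag-between ha hi aqi
    ...   | inj₂ iqb = Product.map₂ (Product.map₁ there) (from-head h′ t walk h′i y∈ yb iqb)
  walk-meets-between (h ∷ t) walk (there x∈) (here refl) xa yb aqb =
    walk-meets-between (h ∷ t) walk (here refl) (there x∈) yb xa (between-sym aqb)
  walk-meets-between (h ∷ t) walk (there x∈) (there y∈) xa yb aqb =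
    Product.map₂ (Product.map₁ there) (walk-meets-between t (walk-tail G walk) x∈ y∈ xa yb aqb)

  common-bag-≤ : ∀ {i j c u v w} → i ≤ j → Bag i u → Bag i v → Bag j v → Bag j w →
    Bag c u → Bag c w → ¬ Bag c v → ∃ λ q → Bag q u × Bag q v × Bag q w
  common-bag-≤ {i} {j} {c} i≤j ui vi vj wj uc wc ¬vc with ≤-total c i
  ... | inj₁ c≤i = i , ui , vi , bag-convex c≤i i≤j wc wj
  ... | inj₂ i≤c with ≤-total c j
  ...   | inj₁ c≤j = contradiction (bag-convex i≤c c≤j vi vj) ¬vc
  ...   | inj₂ j≤c = j , bag-convex i≤j j≤c ui uc , vj , wj

  -- The bags containing v form an interval avoiding c, so whichever of i and j is
  -- nearer to c contains all three vertices.
  common-bag : ∀ {i j c u v w} → Bag i u → Bag i v → Bag j v → Bag j w →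
    Bag c u → Bag c w → ¬ Bag c v → ∃ λ q → Bag q u × Bag q v × Bag q w
  common-bag {i} {j} ui vi vj wj uc wc ¬vc with ≤-total i j
  ... | inj₁ i≤j = common-bag-≤ i≤j ui vi vj wj uc wc ¬vc
  ... | inj₂ j≤i =
    let q , wq , vq , uq = common-bag-≤ j≤i wj vj vi ui wc uc ¬vc in q , uq , vq , wq

  AtMostPerBag : ℕ → Pred (Fin n) 0ℓ → Set
  AtMostPerBag p U = ∀ q xs → Unique xs → All (λ v → U v × Bag q v) xs → length xs ≤ p

  module _ {U : Pred (Fin n) 0ℓ} (one-per-bag : AtMostPerBag 1 U) where

    one-per-bag⇒independent : ∀ {u v} → U u → U v → ¬ Adj G u v
    one-per-bag⇒independent {u} {v} Uu Uv uv with bag-edge uv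
    ... | q , uq , vq
        with one-per-bag q (u ∷ v ∷ []) (((λ { refl → irrefl G uv }) ∷ []) ∷ [] ∷ [])
                         ((Uu , uq) ∷ (Uv , vq) ∷ [])
    ...   | s≤s ()

    one-per-bag⇒short : ∀ c → ShortMonoPaths G c U 1
    one-per-bag⇒short c [] _ = z≤n
    one-per-bag⇒short c (x ∷ []) _ = ≤-refl
    one-per-bag⇒short c (x ∷ y ∷ _) ((xy , _) , _ , Ux ∷ Uy ∷ _ , _) =
      contradiction xy (one-per-bag⇒independent Ux Uy)

  module Cuts (U : Pred (Fin n) 0ℓ) (U? : Decidable U) where

    Cut : ℕ → Set
    Covered : ℕ → Pred (Fin n) 0ℓ

    Cut q = ¬ (∃ λ v → U v × Bag q v × Covered q v)

    Covered zero _ = ⊥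
    Covered (suc q) v = Covered q v ⊎ (Cut q × Bag q v)

    meets-covered? : ∀ q → Dec (∃ λ v → U v × Bag q v × Covered q v)
    covered? : ∀ q → Decidable (Covered q)

    meets-covered? q = any? λ v → U? v ×-dec bag? q v ×-dec covered? q v

    covered? zero _ = no λ ()
    covered? (suc q) v = covered? q v ⊎-dec (¬? (meets-covered? q) ×-dec bag? q v)

    cut? : ∀ q → Dec (Cut q)
    cut? q = ¬? (meets-covered? q)

    covered⇒cut : ∀ {q v} → Covered q v → ∃ λ c → c < q × Cut c × Bag c v
    covered⇒cut {suc q} (inj₁ cov) =
      let c , c<q , cut , vc = covered⇒cut cov in c , m<n⇒m<1+n c<q , cut , vc
    covered⇒cut {suc q} (inj₂ (cut , vq)) = q , ≤-refl , cut , vq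

    cut⇒covered : ∀ {c q v} → c < q → Cut c → Bag c v → Covered q v
    cut⇒covered {q = suc q} c<1+q cut vc with m≤n⇒m<n∨m≡n (s≤s⁻¹ c<1+q)
    ... | inj₁ c<q = inj₁ (cut⇒covered c<q cut vc)
    ... | inj₂ refl = inj₂ (cut , vc)

    cut⇒covered-extent : ∀ {c v} → Cut c → Bag c v → Covered extent v
    cut⇒covered-extent cut vc = cut⇒covered (bag⇒<extent vc) cut vc

    cut-unique : ∀ {c d v} → Cut c → Cut d → U v → Bag c v → Bag d v → c ≡ d
    cut-unique {c} {d} {v} cutc cutd Uv vc vd with <-cmp c d
    ... | tri< c<d _ _ = contradiction (v , Uv , vd , cut⇒covered c<d cutc vc) cutd
    ... | tri≈ _ c≡d _ = c≡d
    ... | tri> _ _ d<c = contradiction (v , Uv , vc , cut⇒covered d<c cutd vd) cutc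

    Uncovered : Pred (Fin n) 0ℓ
    Uncovered v = U v × ¬ Covered extent v

    uncovered? : Decidable Uncovered
    uncovered? v = U? v ×-dec ¬? (covered? extent v)

    covered⇒on-cut : ∀ {v} → U v → ¬ Uncovered v → ∃ λ c → Cut c × Bag c v
    covered⇒on-cut {v} Uv ¬Yv =
      let c , _ , cut , vc = covered⇒cut (decidable-stable (covered? extent v) (λ ¬cov → ¬Yv (Uv , ¬cov)))
      in c , cut , vc

    -- A bag that is not a cut contains a vertex of U covered by an earlier cut.
    uncovered-per-bag : ∀ {p} → AtMostPerBag (suc p) U → AtMostPerBag p Uncovered
    uncovered-per-bag narrow q [] _ _ = z≤n
    uncovered-per-bag narrow q (x ∷ xs) uniq xs∈@(((_ , ¬xcov) , xq) ∷ _) with cut? q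
    ... | yes cut = contradiction (cut⇒covered-extent cut xq) ¬xcov
    ... | no ¬cut with decidable-stable (meets-covered? q) ¬cut
    ...   | v , Uv , vq , vcov =
      s≤s⁻¹ (narrow q (v ∷ x ∷ xs) (All.map v≢ xs∈ ∷ uniq) ((Uv , vq) ∷ All.map (Product.map₁ proj₁) xs∈))
      where
      v-covered : Covered extent v
      v-covered = let c , c<q , cut , vc = covered⇒cut vcov in
                  cut⇒covered (<-trans c<q (bag⇒<extent vq)) cut vc
      v≢ : ∀ {y} → Uncovered y × Bag q y → v ≢ y
      v≢ ((_ , ¬ycov) , _) refl = ¬ycov v-covered

    cutParity : ℕ → Bool
    cutParity zero = false
    cutParity (suc q) with cut? q
    ... | yes _ = not (cutParity q)
    ... | no _ = cutParity q

    cutParity-after-cut : ∀ {c} → Cut c → cutParity (suc c) ≡ not (cutParity c)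
    cutParity-after-cut {c} cut with cut? c
    ... | yes _ = refl
    ... | no ¬cut = contradiction cut ¬cut

    extend : Colouring n → Colouring n
    extend c′ v with covered? extent v
    ... | yes cov = cutParity (proj₁ (covered⇒cut cov))
    ... | no _ = c′ v

    module _ {c′ : Colouring n} where

      extend-uncovered : ∀ {v} → Uncovered v → extend c′ v ≡ c′ v
      extend-uncovered {v} (_ , ¬cov) with covered? extent v
      ... | yes cov = contradiction cov ¬cov
      ... | no _ = refl

      extend-cut : ∀ {c v} → Cut c → Bag c v → U v → extend c′ v ≡ cutParity c
      extend-cut {c} {v} cut vc Uv with covered? extent v
      ... | yes cov = let d , _ , cutd , vd = covered⇒cut cov in cong cutParity (cut-unique cutd cut Uv vd vc)
      ... | no ¬cov = contradiction (cut⇒covered-extent cut vc) ¬cov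

      -- Between two cuts met by the path the parity flips at the next cut, which the
      -- path meets as well.
      monoPath-no-later-cut : ∀ {b xs x y c d} → MonoPath G (extend c′) U b xs → x ∈ xs → y ∈ xs →
        Cut c → Bag c x → Cut d → Bag d y → ¬ c < d
      monoPath-no-later-cut {b} {xs} {x} {y} {c} {d} (walk , _ , inside , mono) x∈ y∈ cutc xc cutd yd c<d =
        contradiction (flipped d c<d ≤-refl) (not-¬ (parity-of y∈ cutd yd))
        where
        parity-of : ∀ {z j} → z ∈ xs → Cut j → Bag j z → cutParity j ≡ b
        parity-of z∈ cutj zj = trans (sym (extend-cut cutj zj (All.lookup inside z∈))) (All.lookup mono z∈)

        flipped : ∀ j → c < j → j ≤ d → cutParity j ≡ not b
        flipped (suc j) c<1+j 1+j≤d with m≤n⇒m<n∨m≡n (s≤s⁻¹ c<1+j)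
        ... | inj₂ refl = trans (cutParity-after-cut cutc) (cong not (parity-of x∈ cutc xc))
        ... | inj₁ c<j with cut? j
        ...   | no _ = flipped j c<j (<⇒≤ 1+j≤d)
        ...   | yes cutj =
          let z , z∈ , zj = walk-meets-between xs walk x∈ y∈ xc yd (inj₁ (<⇒≤ c<j , <⇒≤ 1+j≤d))
          in contradiction (flipped j c<j (<⇒≤ 1+j≤d)) (not-¬ (parity-of z∈ cutj zj))

      monoPath-one-cut : ∀ {b xs x y c d} → MonoPath G (extend c′) U b xs → x ∈ xs → y ∈ xs →
        Cut c → Bag c x → Cut d → Bag d y → c ≡ d
      monoPath-one-cut {c = c} {d} mp x∈ y∈ cutc xc cutd yd with <-cmp c d
      ... | tri< c<d _ _ = contradiction c<d (monoPath-no-later-cut mp x∈ y∈ cutc xc cutd yd)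
      ... | tri≈ _ c≡d _ = c≡d
      ... | tri> _ _ d<c = contradiction d<c (monoPath-no-later-cut mp y∈ x∈ cutd yd cutc xc)

      monoPath-covered-≤ : ∀ {p b xs} → AtMostPerBag (suc p) U → MonoPath G (extend c′) U b xs →
        count (∁? uncovered?) xs ≤ suc p
      monoPath-covered-≤ {p} {b} {xs} narrow mp@(_ , uniq , inside , _) =
        on-one-cut (filter (∁? uncovered?) xs) (Unique.filter⁺ (∁? uncovered?) uniq) (∈-filter⁻ (∁? uncovered?))
        where
        on-one-cut : ∀ ys → Unique ys → (∀ {y} → y ∈ ys → y ∈ xs × ¬ Uncovered y) → length ys ≤ suc p
        on-one-cut [] _ _ = z≤n
        on-one-cut (y₀ ∷ ys) uniq′ ys⊆ with ys⊆ (here refl)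
        ... | y₀∈ , ¬Yy₀ with covered⇒on-cut (All.lookup inside y₀∈) ¬Yy₀
        ...   | c , cutc , y₀c = narrow c (y₀ ∷ ys) uniq′ (All.tabulate in-c)
          where
          in-c : ∀ {y} → y ∈ y₀ ∷ ys → U y × Bag c y
          in-c {y} y∈ with ys⊆ y∈
          ... | y∈xs , ¬Yy with covered⇒on-cut (All.lookup inside y∈xs) ¬Yy
          ...   | d , cutd , yd =
            All.lookup inside y∈xs ,
            subst (λ k → Bag k y) (monoPath-one-cut mp y∈xs y₀∈ cutd yd cutc y₀c) yd

      extend-short : ∀ {p M} → AtMostPerBag (suc p) U → ShortMonoPaths G c′ Uncovered M →
        ShortMonoPaths G (extend c′) U (suc p + suc (suc p) * M)
      extend-short {p} {M} narrow short′ {b} xs mp =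
        ≤-trans (length-≤-runs uncovered? (MonoPath G (extend c′) U b)
                               (monoPath-++⁻ˡ G) (monoPath-++⁻ʳ G) M restricted xs mp)
                (+-mono-≤ covered≤ (*-monoˡ-≤ M (s≤s covered≤)))
        where
        covered≤ : count (∁? uncovered?) xs ≤ suc p
        covered≤ = monoPath-covered-≤ narrow mp
        restricted : ∀ ys → MonoPath G (extend c′) U b ys → All Uncovered ys → length ys ≤ M
        restricted ys (walk , uniq , _ , mono) Yys =
          short′ ys (walk , uniq , Yys , All.zipWith (λ (Yy , ≡b) → trans (sym (extend-uncovered Yy)) ≡b) (Yys , mono))

      module _ (narrow : AtMostPerBag 2 U) where

        uncovered-independent : ∀ {u v} → Uncovered u → Uncovered v → ¬ Adj G u v
        uncovered-independent = one-per-bag⇒independent (uncovered-per-bag narrow)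

        -- Both neighbours of an inner uncovered vertex v would lie on one cut c that
        -- misses v, forcing u, v, w into a common bag.
        monoPath-inner-covered : ∀ {b u v w xs} → MonoPath G (extend c′) U b (u ∷ v ∷ w ∷ xs) →
          ¬ Uncovered v
        monoPath-inner-covered {u = u} {v} {w} mp@((uv , vw , _) , uniq , Uu ∷ Uv ∷ Uw ∷ _ , _) Yv
          with covered⇒on-cut Uu (λ Yu → uncovered-independent Yu Yv uv)
             | covered⇒on-cut Uw (λ Yw → uncovered-independent Yv Yw vw)
        ... | c , cutc , uc | d , cutd , wd with bag-edge uv | bag-edge vw
        ... | i , ui , vi | j , vj , wj
          with common-bag ui vi vj wj uc
                 (subst (λ k → Bag k w) (monoPath-one-cut mp (there (there (here refl))) (here refl) cutd wd cutc uc) wd)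
                 (λ vc → proj₂ Yv (cut⇒covered-extent cutc vc))
        ... | q , uq , vq , wq with uniq
        ... | (u≢v ∷ u≢w ∷ _) ∷ (v≢w ∷ _) ∷ _
          with narrow q (u ∷ v ∷ w ∷ []) ((u≢v ∷ u≢w ∷ []) ∷ (v≢w ∷ []) ∷ [] ∷ [])
                      ((Uu , uq) ∷ (Uv , vq) ∷ (Uw , wq) ∷ [])
        ... | s≤s (s≤s ())

        monoPath-inner : ∀ {b} xs → MonoPath G (extend c′) U b xs → AllInner (∁? uncovered?) xs
        monoPath-inner [] _ = tt
        monoPath-inner (_ ∷ []) _ = tt
        monoPath-inner (_ ∷ _ ∷ []) _ = tt
        monoPath-inner (u ∷ v ∷ w ∷ xs) mp =
          monoPath-inner-covered mp , monoPath-inner (v ∷ w ∷ xs) (monoPath-++⁻ʳ G [ u ] _ mp)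

        extend-short-2 : ShortMonoPaths G (extend c′) U 4
        extend-short-2 xs mp =
          ≤-trans (length-≤-2+count (∁? uncovered?) xs (monoPath-inner xs mp))
                  (+-monoʳ-≤ 2 (monoPath-covered-≤ narrow mp))

  colouring : ∀ w (U : Pred (Fin n) 0ℓ) → Decidable U → AtMostPerBag (suc w) U →
    Σ (Colouring n) λ c → ShortMonoPaths G c U (pathBound w)
  colouring zero U U? narrow = (λ _ → true) , one-per-bag⇒short narrow (λ _ → true)
  colouring (suc zero) U U? narrow = let open Cuts U U? in extend (λ _ → true) , extend-short-2 narrow
  colouring (suc (suc w)) U U? narrow =
    let open Cuts U U?
        c′ , short′ = colouring (suc w) Uncovered uncovered? (uncovered-per-bag narrow)
    in extend c′ , extend-short narrow short′

length≤∣∣ : ∀ {m} (S : Subset.Subset m) xs → Unique xs → All (Subset._∈ S) xs →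
  length xs ≤ Subset.∣ S ∣
length≤∣∣ S [] _ _ = z≤n
length≤∣∣ S (x ∷ xs) (x∉ ∷ uniq) (x∈ ∷ xs∈) =
  ≤-trans (s≤s (length≤∣∣ (S Subset.- x) xs uniq xs∈S-x)) (Subset.x∈p⇒∣p-x∣<∣p∣ x∈)
  where
  xs∈S-x : All (Subset._∈ S Subset.- x) xs
  xs∈S-x = All.zipWith (λ (y∈ , x≢y) → Subset.x∈p∧x≢y⇒x∈p-y y∈ (x≢y ∘ sym)) (xs∈ , x∉)

module _ {n : ℕ} {G : Graph n} (D : PathDecomposition G) where

  bagAt : ℕ → Subset.Subset n
  bagAt q with q <? len D
  ... | yes q<L = bag D (fromℕ< q<L)
  ... | no _ = Subset.⊥

  bagAt-fromℕ< : ∀ {q} (q<L : q < len D) → bagAt q ≡ bag D (fromℕ< q<L)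
  bagAt-fromℕ< {q} q<L with q <? len D
  ... | yes _ = refl
  ... | no q≮L = contradiction q<L q≮L

  bagAt-< : ∀ {q v} → v Subset.∈ bagAt q → q < len D
  bagAt-< {q} v∈ with q <? len D
  ... | yes q<L = q<L
  ... | no _ = contradiction v∈ Subset.∉⊥

  toBagSequence : BagSequence G
  toBagSequence = record
    { Bag = λ q v → v Subset.∈ bagAt q
    ; bag? = λ q v → v Subset.∈? bagAt q
    ; extent = len D
    ; bag⇒<extent = bagAt-<
    ; bag-convex = convex
    ; bag-edge = edge
    }
    where
    convex : ∀ {i j k v} → i ≤ j → j ≤ k → v Subset.∈ bagAt i → v Subset.∈ bagAt k → v Subset.∈ bagAt j
    convex {i} {j} {k} {v} i≤j j≤k vi vk =
      subst (v Subset.∈_) (sym (bagAt-fromℕ< j<L))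
        (interval D v (fromℕ< i<L) (fromℕ< j<L) (fromℕ< k<L)
          (subst₂ _≤_ (sym (toℕ-fromℕ< i<L)) (sym (toℕ-fromℕ< j<L)) i≤j)
          (subst₂ _≤_ (sym (toℕ-fromℕ< j<L)) (sym (toℕ-fromℕ< k<L)) j≤k)
          (subst (v Subset.∈_) (bagAt-fromℕ< i<L) vi)
          (subst (v Subset.∈_) (bagAt-fromℕ< k<L) vk))
      where
      i<L : i < len D
      i<L = bagAt-< vi
      k<L : k < len D
      k<L = bagAt-< vk
      j<L : j < len D
      j<L = ≤-<-trans j≤k k<L

    edge : ∀ {u v} → Adj G u v → ∃ λ q → u Subset.∈ bagAt q × v Subset.∈ bagAt q
    edge {u} {v} uv with edges D u v uv
    ... | i , ui , vi = toℕ i , subst (u Subset.∈_) (sym bagAt-toℕ) ui , subst (v Subset.∈_) (sym bagAt-toℕ) vi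
      where
      bagAt-toℕ : bagAt (toℕ i) ≡ bag D i
      bagAt-toℕ = trans (bagAt-fromℕ< (toℕ<n i)) (cong (bag D) (fromℕ<-toℕ i (toℕ<n i)))

  width⇒at-most-per-bag : ∀ {w} → WidthAtMost D w → AtMostPerBag toBagSequence (suc w) (λ _ → ⊤)
  width⇒at-most-per-bag {w} narrow q xs uniq xs∈ =
    ≤-trans (length≤∣∣ (bagAt q) xs uniq (All.map proj₂ xs∈))
            (subst (Subset.∣ bagAt q ∣ ≤_) (+-comm w 1) bagAt-size)
    where
    bagAt-size : Subset.∣ bagAt q ∣ ≤ w + 1
    bagAt-size with q <? len D
    ... | yes q<L = narrow (fromℕ< q<L)
    ... | no _ = subst (_≤ w + 1) (sym (Subset.∣⊥∣≡0 n)) z≤n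

lemma9 : (w n : ℕ) (G : Graph n) → PathwidthAtMost G w →
    Σ (Colouring n) λ c → ∀ (P : List (Fin n)) → IsPath G P → Monochromatic c P →
    length P ≤ (w + 3) ^ w
lemma9 w n G (D , narrow)
  with colouring (toBagSequence D) w (λ _ → ⊤) (λ _ → yes tt) (width⇒at-most-per-bag D narrow)
... | c , short = c , λ P (_ , uniq , walk) (_ , mono) →
  ≤-trans (short P (walk , uniq , All.universal (λ _ → tt) P , mono))
          (subst (λ a → pathBound w ≤ a ^ w) (+-comm 3 w) (pathBound-≤ w))
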